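{- Let $(e_k)_{k\ge0}$ be a $q$-Catalan basis associated to the Catalan power series $P$, and let $T$ be the linear operator on power series defined by $Te_k=q^ke_k$ for all $k\ge0$. Then for every $n\ge0$ and every power series $f$, $$[e_n]f=q^n[z^0]\Bigl(\frac{\Delta P(z,T,q^n)f(z)}{e_n(qz)P(z,1)}\Bigr),$$ where $([e_n])$ are the dual forms of $(e_n)$.
   Context: $q$ is a fixed parameter; all series are formal. A Catalan power series is a power series $P(z,t)$ with $P(z,t)=t-z\tilde P(z,t)t^2$ for some power series $\tilde P$. A family of power series $(e_k)_{k\ge0}$ is a $q$-Catalan basis associated to $P$ if $e_k(qz)/e_k(z)=P(z,q^k)/P(z,1)$ for all $k\ge0$; each $e_k$ then has order $k$, so $(e_k)$ is a basis of power series, and the dual forms are the linear forms $[e_n]$ with $[e_n]\bigl(\sum_kc_ke_k\bigr)=c_n$. $\Delta P(z,s,t)=\frac{P(z,s)-P(z,t)}{s-t}$ is a power series in $(z,s,t)$ with monomials written $z^as^bt^c$; $\Delta P(z,T,q^n)$ is the operator $f\mapsto\sum_{a,b,c}[z^as^bt^c]\Delta P\;q^{nc}z^aT^bf$. -}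

module Defs where

open import Level using (Level; _⊔_) renaming (suc to lsuc)
open import Algebra.Bundles using (CommutativeRing)
open import Data.Nat using (ℕ; zero; suc; _∸_) renaming (_+_ to _+ℕ_)
open import Data.List using (List; []; _∷_; foldr; length)
open import Data.Product using (∃)
open import Relation.Nullary using (¬_)

record Field (c ℓ : Level) : Set (lsuc (c ⊔ ℓ)) where
  field
    commutativeRing : CommutativeRing c ℓ
  open CommutativeRing commutativeRing public
  field
    0≉1     : ¬ (0# ≈ 1#)
    inverse : ∀ x → ¬ (x ≈ 0#) → ∃ λ y → x * y ≈ 1#

module FieldOps {c ℓ : Level} (F : Field c ℓ) where
  open Field F

  pow : Carrier → ℕ → Carrier
  pow x zero    = 1#
  pow x (suc n) = x * pow x n

  Σ< : ℕ → (ℕ → Carrier) → Carrier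
  Σ< zero    f = 0#
  Σ< (suc n) f = Σ< n f + f n

  Σ≤ : ℕ → (ℕ → Carrier) → Carrier
  Σ≤ n f = Σ< (suc n) f

  Series : Set c
  Series = ℕ → Carrier

  _≈ₛ_ : Series → Series → Set ℓ
  f ≈ₛ g = ∀ m → f m ≈ g m

  zeroS : Series
  zeroS _ = 0#

  _⋆_ : Series → Series → Series
  (f ⋆ g) m = Σ≤ m (λ i → f i * g (m ∸ i))

  dilate : Carrier → Series → Series
  dilate q f m = pow q m * f m

  shift : ℕ → Series → Series
  shift zero    f m       = f m
  shift (suc N) f zero    = 0#
  shift (suc N) f (suc m) = shift N f m

  -- Series in (z,t) which are polynomial in t for each power of z:
  -- P a is the list of coefficients (in increasing powers of t) of z^a.
  ZTSeries : Set c
  ZTSeries = ℕ → List Carrier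

  coeffL : List Carrier → ℕ → Carrier
  coeffL []       _       = 0#
  coeffL (x ∷ xs) zero    = x
  coeffL (x ∷ xs) (suc j) = coeffL xs j

  evalL : List Carrier → Carrier → Carrier
  evalL xs x = foldr (λ a acc → a + x * acc) 0# xs

  evalAt : ZTSeries → Carrier → Series
  evalAt P x a = evalL (P a) x

  -- coefficient [z^a t^j] of t  (i.e. 1 if a = 0, j = 1)
  tCoeff : ℕ → ℕ → Carrier
  tCoeff zero (suc zero) = 1#
  tCoeff _    _          = 0#

  -- coefficient [z^a t^j] of  z · P̃(z,t) · t²
  zt²Coeff : ZTSeries → ℕ → ℕ → Carrier
  zt²Coeff Pt (suc a) (suc (suc j)) = coeffL (Pt a) j
  zt²Coeff Pt _       _             = 0#

  -- Catalan power series: P(z,t) = t - z P̃(z,t) t² for some P̃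
  Catalan : ZTSeries → Set (c ⊔ ℓ)
  Catalan P = ∃ λ (Pt : ZTSeries) →
    ∀ a j → coeffL (P a) j ≈ tCoeff a j - zt²Coeff Pt a j

  -- [z^a s^b t^c] ΔP  where ΔP(z,s,t) = (P(z,s) - P(z,t))/(s - t):
  -- since (s^j - t^j)/(s - t) = Σ_{b+c=j-1} s^b t^c, this is [z^a t^(b+c+1)] P.
  ΔPcoeff : ZTSeries → ℕ → ℕ → ℕ → Carrier
  ΔPcoeff P a b c = coeffL (P a) (suc (b +ℕ c))

  -- cs are coordinates of f in the family e:  f = Σ_k cs_k e_k
  -- (coefficientwise; e_k has order k, so only k ≤ m contribute to z^m)
  Coords : (ℕ → Series) → Series → (ℕ → Carrier) → Set ℓ
  Coords e f cs = ∀ m → f m ≈ Σ≤ m (λ k → cs k * e k m)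

  -- T^b f, where T e_k = q^k e_k and f = Σ_k cs_k e_k
  Tpow : (ℕ → Series) → Carrier → (ℕ → Carrier) → ℕ → Series
  Tpow e q cs b m = Σ≤ m (λ k → cs k * pow (pow q k) b * e k m)

  -- ΔP(z,T,q^n) f = Σ_{a,b,c} [z^a s^b t^c]ΔP · q^{nc} z^a T^b f ,
  -- f given by its coordinates cs.  For fixed a the sum over (b,c) is finite:
  -- j = b + c ranges below length (P a).
  ΔPop : ZTSeries → (ℕ → Series) → Carrier → (ℕ → Carrier) → ℕ → Series
  ΔPop P e q cs n m =
    Σ≤ m (λ a → Σ< (length (P a)) (λ j → Σ≤ j (λ b →
      ΔPcoeff P a b (j ∸ b) * pow (pow q n) (j ∸ b) * Tpow e q cs b (m ∸ a))))

module Submission where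

-- Write e_n = z^n u with u(0) ≠ 0 (e_n has order exactly n)
-- and put  W = u(qz)⁻¹ P(z,1)⁻¹, so that D W = q^n z^n for the denominator
-- D = e_n(qz) P(z,1).  Dividing by D thus amounts to multiplying by W and
-- reading off the coefficient of z^n.  Up to degree n,
-- ΔP(z,T,q^n) f = Σ_{k≤n} c_k ΔP(z,q^k,q^n) e_k, and the divided-difference
-- identity  q^k ΔP(z,q^k,q^n) + P(z,q^n) = q^n ΔP(z,q^k,q^n) + P(z,q^k),
-- multiplied by e_k W and combined with the q-Catalan equation, shows that
-- [z^n] ΔP(z,q^k,q^n) e_k W vanishes for k ≠ n (as q^k ≠ q^n) and equals 1
-- for k = n (as P(0,t) = t).  Hence [z^n] (ΔP(z,T,q^n) f) W = c_n.

open import Level using (Level)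
open import Defs
open import Data.Nat as ℕ using (ℕ; zero; suc; _∸_; _<_; _≤_; z≤n; s≤s; _<?_) renaming (_+_ to _+ℕ_)
import Data.Nat.Properties as ℕₚ
open import Data.Product using (∃; _×_; _,_; proj₁; proj₂)
open import Data.List using (List; []; _∷_; length)
open import Data.Sum using (inj₁; inj₂)
open import Data.Empty using (⊥-elim)
open import Function using (_∘_)
open import Relation.Nullary using (¬_; yes; no)
open import Algebra.Bundles using (CommutativeMonoid)
import Algebra.Solver.CommutativeMonoid as CommutativeMonoidSolver
import Relation.Binary.PropositionalEquality as ≡
open ≡ using (_≡_)

module Theory {c ℓ : Level} (F : Field c ℓ) where
  open Field F hiding (zero)
  open FieldOps F
  open import Relation.Binary.Reasoning.Setoid setoid
  open import Algebra.Solver.Ring.NaturalCoefficients.Default commutativeSemiring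
    using (solve; _:+_; _:*_; _:=_; con)
  open import Algebra.Properties.Ring ring using (-‿distribˡ-*; -‿distribʳ-*; +-cancelʳ)
  open import Algebra.Properties.AbelianGroup +-abelianGroup using (xyx⁻¹≈y)
  open import Algebra.Properties.Group +-group using () renaming (ε⁻¹≈ε to -0#≈0#)

  ≡⇒≈ : ∀ {x y} → x ≡ y → x ≈ y
  ≡⇒≈ ≡.refl = refl

  x+[y-x]≈y : ∀ x y → x + (y - x) ≈ y
  x+[y-x]≈y x y = trans (sym (+-assoc x y (- x))) (xyx⁻¹≈y x y)

  *-cancel-≉ : ∀ {s t} X → ¬ (s ≈ t) → s * X ≈ t * X → X ≈ 0#
  *-cancel-≉ {s} {t} X s≉t sX≈tX = begin
    X                  ≈⟨ sym (*-identityˡ X) ⟩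
    1# * X             ≈⟨ *-cong (sym (trans (*-comm _ _) (proj₂ inv))) refl ⟩
    (d⁻¹ * (s - t)) * X ≈⟨ *-assoc _ _ _ ⟩
    d⁻¹ * ((s - t) * X) ≈⟨ *-cong refl [s-t]X≈0 ⟩
    d⁻¹ * 0#           ≈⟨ zeroʳ _ ⟩
    0#                 ∎
    where
    s-t≉0 : ¬ (s - t ≈ 0#)
    s-t≉0 s-t≈0 = s≉t (begin
      s           ≈⟨ sym (x+[y-x]≈y t s) ⟩
      t + (s - t) ≈⟨ +-cong refl s-t≈0 ⟩
      t + 0#      ≈⟨ +-identityʳ t ⟩
      t           ∎)
    inv : ∃ λ y → (s - t) * y ≈ 1#
    inv = inverse (s - t) s-t≉0
    d⁻¹ : Carrier
    d⁻¹ = proj₁ inv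
    [s-t]X≈0 : (s - t) * X ≈ 0#
    [s-t]X≈0 = begin
      (s - t) * X       ≈⟨ distribʳ X s (- t) ⟩
      s * X + (- t) * X ≈⟨ +-cong sX≈tX (sym (-‿distribˡ-* t X)) ⟩
      t * X - t * X     ≈⟨ -‿inverseʳ _ ⟩
      0#                ∎

  pow-+ : ∀ x a b → pow x (a +ℕ b) ≈ pow x a * pow x b
  pow-+ x zero    b = sym (*-identityˡ _)
  pow-+ x (suc a) b = trans (*-cong refl (pow-+ x a b)) (sym (*-assoc _ _ _))

  Σ<-cong : ∀ n {f g : ℕ → Carrier} → (∀ i → f i ≈ g i) → Σ< n f ≈ Σ< n g
  Σ<-cong zero    h = refl
  Σ<-cong (suc n) h = +-cong (Σ<-cong n h) (h n)

  Σ<-cong-< : ∀ n {f g : ℕ → Carrier} → (∀ i → i < n → f i ≈ g i) → Σ< n f ≈ Σ< n g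
  Σ<-cong-< zero    h = refl
  Σ<-cong-< (suc n) h = +-cong (Σ<-cong-< n (λ i i<n → h i (ℕₚ.m<n⇒m<1+n i<n))) (h n (ℕₚ.n<1+n n))

  Σ<-zero : ∀ n {f : ℕ → Carrier} → (∀ i → i < n → f i ≈ 0#) → Σ< n f ≈ 0#
  Σ<-zero zero    h = refl
  Σ<-zero (suc n) h = trans (+-cong (Σ<-zero n (λ i i<n → h i (ℕₚ.m<n⇒m<1+n i<n))) (h n (ℕₚ.n<1+n n))) (+-identityʳ 0#)

  Σ<-+ : ∀ n (f g : ℕ → Carrier) → Σ< n (λ i → f i + g i) ≈ Σ< n f + Σ< n g
  Σ<-+ zero    f g = sym (+-identityʳ 0#)
  Σ<-+ (suc n) f g = begin
    Σ< n (λ i → f i + g i) + (f n + g n) ≈⟨ +-cong (Σ<-+ n f g) refl ⟩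
    (Σ< n f + Σ< n g) + (f n + g n)      ≈⟨ solve 4 (λ a b c d → (a :+ b) :+ (c :+ d) := (a :+ c) :+ (b :+ d)) refl (Σ< n f) (Σ< n g) (f n) (g n) ⟩
    (Σ< n f + f n) + (Σ< n g + g n)      ∎

  Σ<-*ˡ : ∀ n x (f : ℕ → Carrier) → x * Σ< n f ≈ Σ< n (λ i → x * f i)
  Σ<-*ˡ zero    x f = zeroʳ x
  Σ<-*ˡ (suc n) x f = trans (distribˡ x (Σ< n f) (f n)) (+-cong (Σ<-*ˡ n x f) refl)

  Σ<-*ʳ : ∀ n x (f : ℕ → Carrier) → Σ< n f * x ≈ Σ< n (λ i → f i * x)
  Σ<-*ʳ zero    x f = zeroˡ x
  Σ<-*ʳ (suc n) x f = trans (distribʳ x (Σ< n f) (f n)) (+-cong (Σ<-*ʳ n x f) refl)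

  Σ<-first : ∀ n (f : ℕ → Carrier) → Σ< (suc n) f ≈ f 0 + Σ< n (f ∘ suc)
  Σ<-first zero    f = trans (+-identityˡ (f 0)) (sym (+-identityʳ (f 0)))
  Σ<-first (suc n) f = trans (+-cong (Σ<-first n f) refl) (+-assoc (f 0) _ _)

  Σ<-swap : ∀ n m (G : ℕ → ℕ → Carrier) → Σ< n (λ i → Σ< m (G i)) ≈ Σ< m (λ k → Σ< n (λ i → G i k))
  Σ<-swap zero    m G = sym (Σ<-zero m (λ _ _ → refl))
  Σ<-swap (suc n) m G = trans (+-cong (Σ<-swap n m G) refl) (sym (Σ<-+ m _ (G n)))

  Σ<-extend : ∀ m n (f : ℕ → Carrier) → m ≤ n → (∀ i → m ≤ i → i < n → f i ≈ 0#) → Σ< m f ≈ Σ< n f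
  Σ<-extend m zero    f z≤n h = refl
  Σ<-extend m (suc n) f m≤1+n h with ℕₚ.m≤n⇒m<n∨m≡n m≤1+n
  ... | inj₂ ≡.refl    = refl
  ... | inj₁ (s≤s m≤n) = begin
    Σ< m f       ≈⟨ Σ<-extend m n f m≤n (λ i m≤i i<n → h i m≤i (ℕₚ.m<n⇒m<1+n i<n)) ⟩
    Σ< n f       ≈⟨ sym (+-identityʳ _) ⟩
    Σ< n f + 0#  ≈⟨ +-cong refl (sym (h n m≤n (ℕₚ.n<1+n n))) ⟩
    Σ< n f + f n ∎

  Σ<-reverse : ∀ n (f : ℕ → Carrier) → Σ< n f ≈ Σ< n (λ i → f (n ∸ suc i))
  Σ<-reverse zero    f = refl
  Σ<-reverse (suc n) f = begin
    Σ< n f + f n                     ≈⟨ +-cong (Σ<-reverse n f) refl ⟩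
    Σ< n (λ i → f (n ∸ suc i)) + f n ≈⟨ +-comm _ _ ⟩
    f n + Σ< n (λ i → f (n ∸ suc i)) ≈⟨ sym (Σ<-first n (λ i → f (n ∸ i))) ⟩
    Σ< (suc n) (λ i → f (n ∸ i))     ∎

  Σ≤-triangle : ∀ m (G : ℕ → ℕ → Carrier) →
    Σ≤ m (λ s → Σ≤ s (λ i → G i s)) ≈ Σ≤ m (λ i → Σ≤ (m ∸ i) (λ j → G i (i +ℕ j)))
  Σ≤-triangle zero    G = refl
  Σ≤-triangle (suc m) G = begin
    Σ≤ m (λ s → Σ≤ s (λ i → G i s)) + Σ≤ (suc m) (λ i → G i (suc m))
      ≈⟨ +-cong (Σ≤-triangle m G) refl ⟩
    Rows m + (Σ< (suc m) (λ i → G i (suc m)) + G (suc m) (suc m))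
      ≈⟨ sym (+-assoc _ _ _) ⟩
    (Rows m + Σ< (suc m) (λ i → G i (suc m))) + G (suc m) (suc m)
      ≈⟨ +-cong (sym (Σ<-+ (suc m) _ _)) lastRow ⟩
    Σ< (suc m) (λ i → Σ≤ (m ∸ i) (λ j → G i (i +ℕ j)) + G i (suc m)) + Σ≤ (suc m ∸ suc m) (λ j → G (suc m) (suc m +ℕ j))
      ≈⟨ +-cong (Σ<-cong-< (suc m) extendRow) refl ⟩
    Σ< (suc m) (λ i → Σ≤ (suc m ∸ i) (λ j → G i (i +ℕ j))) + Σ≤ (suc m ∸ suc m) (λ j → G (suc m) (suc m +ℕ j)) ∎
    where
    Rows : ℕ → Carrier
    Rows m = Σ≤ m (λ i → Σ≤ (m ∸ i) (λ j → G i (i +ℕ j)))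
    lastRow : G (suc m) (suc m) ≈ Σ≤ (suc m ∸ suc m) (λ j → G (suc m) (suc m +ℕ j))
    lastRow rewrite ℕₚ.n∸n≡0 m | ℕₚ.+-identityʳ m = sym (+-identityˡ _)
    extendRow : ∀ i → i < suc m → Σ≤ (m ∸ i) (λ j → G i (i +ℕ j)) + G i (suc m) ≈ Σ≤ (suc m ∸ i) (λ j → G i (i +ℕ j))
    extendRow i (s≤s i≤m) rewrite ℕₚ.+-∸-assoc 1 i≤m =
      +-cong refl (≡⇒≈ (≡.cong (G i) (≡.trans (≡.sym (ℕₚ.m+[n∸m]≡n (ℕₚ.m≤n⇒m≤1+n i≤m))) (≡.cong (i +ℕ_) (ℕₚ.+-∸-assoc 1 i≤m)))))

  oneS : Series
  oneS zero    = 1#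
  oneS (suc m) = 0#

  infixr 7 _·ₛ_
  infixl 6 _+ₛ_

  _·ₛ_ : Carrier → Series → Series
  (x ·ₛ f) m = x * f m

  _+ₛ_ : Series → Series → Series
  (f +ₛ g) m = f m + g m

  ≈ₛ-refl : ∀ {f} → f ≈ₛ f
  ≈ₛ-refl m = refl

  ≈ₛ-sym : ∀ {f g} → f ≈ₛ g → g ≈ₛ f
  ≈ₛ-sym h m = sym (h m)

  infixr 4 _▹_
  _▹_ : ∀ {f g h} → f ≈ₛ g → g ≈ₛ h → f ≈ₛ h
  (p ▹ q) m = trans (p m) (q m)

  ·ₛ-cong : ∀ x {f g} → f ≈ₛ g → (x ·ₛ f) ≈ₛ (x ·ₛ g)
  ·ₛ-cong x h m = *-cong refl (h m)

  ⋆-cong : ∀ {f f′ g g′} → f ≈ₛ f′ → g ≈ₛ g′ → (f ⋆ g) ≈ₛ (f′ ⋆ g′)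
  ⋆-cong p q m = Σ<-cong (suc m) (λ i → *-cong (p i) (q (m ∸ i)))

  ⋆-at-0 : ∀ f g → (f ⋆ g) 0 ≈ f 0 * g 0
  ⋆-at-0 f g = +-identityˡ _

  ⋆-comm : ∀ f g → (f ⋆ g) ≈ₛ (g ⋆ f)
  ⋆-comm f g m = begin
    Σ≤ m (λ i → f i * g (m ∸ i))             ≈⟨ Σ<-reverse (suc m) _ ⟩
    Σ≤ m (λ i → f (m ∸ i) * g (m ∸ (m ∸ i))) ≈⟨ Σ<-cong-< (suc m) swapFactors ⟩
    Σ≤ m (λ i → g i * f (m ∸ i))             ∎
    where
    swapFactors : ∀ i → i < suc m → f (m ∸ i) * g (m ∸ (m ∸ i)) ≈ g i * f (m ∸ i)
    swapFactors i (s≤s i≤m) = trans (*-comm _ _) (*-cong (≡⇒≈ (≡.cong g (ℕₚ.m∸[m∸n]≡n i≤m))) refl)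

  ⋆-assoc : ∀ f g h → ((f ⋆ g) ⋆ h) ≈ₛ (f ⋆ (g ⋆ h))
  ⋆-assoc f g h m = begin
    Σ≤ m (λ s → Σ≤ s (λ i → f i * g (s ∸ i)) * h (m ∸ s))
      ≈⟨ Σ<-cong (suc m) (λ s → Σ<-*ʳ (suc s) _ _) ⟩
    Σ≤ m (λ s → Σ≤ s (λ i → f i * g (s ∸ i) * h (m ∸ s)))
      ≈⟨ Σ≤-triangle m (λ i s → f i * g (s ∸ i) * h (m ∸ s)) ⟩
    Σ≤ m (λ i → Σ≤ (m ∸ i) (λ j → f i * g ((i +ℕ j) ∸ i) * h (m ∸ (i +ℕ j))))
      ≈⟨ Σ<-cong (suc m) (λ i → Σ<-cong (suc (m ∸ i)) (λ j → reindex i j)) ⟩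
    Σ≤ m (λ i → Σ≤ (m ∸ i) (λ j → f i * (g j * h ((m ∸ i) ∸ j))))
      ≈⟨ Σ<-cong (suc m) (λ i → sym (Σ<-*ˡ (suc (m ∸ i)) _ _)) ⟩
    Σ≤ m (λ i → f i * Σ≤ (m ∸ i) (λ j → g j * h ((m ∸ i) ∸ j))) ∎
    where
    reindex : ∀ i j → f i * g ((i +ℕ j) ∸ i) * h (m ∸ (i +ℕ j)) ≈ f i * (g j * h ((m ∸ i) ∸ j))
    reindex i j = trans (*-assoc _ _ _)
      (*-cong refl (*-cong (≡⇒≈ (≡.cong g (ℕₚ.m+n∸m≡n i j))) (≡⇒≈ (≡.cong h (≡.sym (ℕₚ.∸-+-assoc m i j))))))

  ⋆-identityʳ : ∀ f → (f ⋆ oneS) ≈ₛ f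
  ⋆-identityʳ f m = begin
    Σ< m (λ i → f i * oneS (m ∸ i)) + f m * oneS (m ∸ m) ≈⟨ +-cong (Σ<-zero m offDiagonal) (*-cong refl (≡⇒≈ (≡.cong oneS (ℕₚ.n∸n≡0 m)))) ⟩
    0# + f m * 1#                                        ≈⟨ trans (+-identityˡ _) (*-identityʳ _) ⟩
    f m                                                  ∎
    where
    offDiagonal : ∀ i → i < m → f i * oneS (m ∸ i) ≈ 0#
    offDiagonal i (s≤s i<m) rewrite ℕₚ.+-∸-assoc 1 i<m = zeroʳ _

  ⋆-identityˡ : ∀ f → (oneS ⋆ f) ≈ₛ f
  ⋆-identityˡ f = ⋆-comm oneS f ▹ ⋆-identityʳ f

  ⋆-at-orderˡ : ∀ m f g → (∀ i → i < m → f i ≈ 0#) → (f ⋆ g) m ≈ f m * g 0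
  ⋆-at-orderˡ m f g h = begin
    Σ< m (λ i → f i * g (m ∸ i)) + f m * g (m ∸ m) ≈⟨ +-cong (Σ<-zero m (λ i i<m → trans (*-cong (h i i<m) refl) (zeroˡ _))) (*-cong refl (≡⇒≈ (≡.cong g (ℕₚ.n∸n≡0 m)))) ⟩
    0# + f m * g 0                                 ≈⟨ +-identityˡ _ ⟩
    f m * g 0                                      ∎

  ⋆-at-orderʳ : ∀ m f g → (∀ i → i < m → f i ≈ 0#) → (g ⋆ f) m ≈ g 0 * f m
  ⋆-at-orderʳ m f g h = trans (⋆-comm g f m) (trans (⋆-at-orderˡ m f g h) (*-comm _ _))

  ⋆-*ˡ : ∀ x f g → ((x ·ₛ f) ⋆ g) ≈ₛ (x ·ₛ (f ⋆ g))
  ⋆-*ˡ x f g m = trans (Σ<-cong (suc m) (λ i → *-assoc _ _ _)) (sym (Σ<-*ˡ (suc m) x _))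

  ⋆-*ʳ : ∀ x f g → (f ⋆ (x ·ₛ g)) ≈ₛ (x ·ₛ (f ⋆ g))
  ⋆-*ʳ x f g = ⋆-comm f _ ▹ ⋆-*ˡ x g f ▹ ·ₛ-cong x (⋆-comm g f)

  ⋆-distribʳ : ∀ f g h → ((f +ₛ g) ⋆ h) ≈ₛ ((f ⋆ h) +ₛ (g ⋆ h))
  ⋆-distribʳ f g h m = trans (Σ<-cong (suc m) (λ i → distribʳ _ _ _)) (Σ<-+ (suc m) _ _)

  ⋆-affine : ∀ x A B C → (((x ·ₛ A) +ₛ B) ⋆ C) ≈ₛ ((x ·ₛ (A ⋆ C)) +ₛ (B ⋆ C))
  ⋆-affine x A B C = ⋆-distribʳ (x ·ₛ A) B C ▹ (λ m → +-cong (⋆-*ˡ x A C m) refl)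

  seriesMonoid : CommutativeMonoid c ℓ
  seriesMonoid = record
    { Carrier = Series ; _≈_ = _≈ₛ_ ; _∙_ = _⋆_ ; ε = oneS
    ; isCommutativeMonoid = record
      { isMonoid = record
        { isSemigroup = record
          { isMagma = record
            { isEquivalence = record { refl = ≈ₛ-refl ; sym = ≈ₛ-sym ; trans = _▹_ }
            ; ∙-cong = ⋆-cong }
          ; assoc = ⋆-assoc }
        ; identity = ⋆-identityˡ , ⋆-identityʳ }
      ; comm = ⋆-comm } }

  module ⋆-Solver = CommutativeMonoidSolver seriesMonoid

  shift-cong : ∀ n {f g} → f ≈ₛ g → shift n f ≈ₛ shift n g
  shift-cong zero    h m       = h m
  shift-cong (suc n) h zero    = refl
  shift-cong (suc n) h (suc m) = shift-cong n h m

  shift-at : ∀ n f m → shift n f (n +ℕ m) ≡ f m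
  shift-at zero    f m = ≡.refl
  shift-at (suc n) f m = shift-at n f m

  shift-at-n : ∀ n f → shift n f n ≡ f 0
  shift-at-n n f = ≡.subst (λ x → shift n f x ≡ f 0) (ℕₚ.+-identityʳ n) (shift-at n f 0)

  shift-injective : ∀ n {f g} → shift n f ≈ₛ shift n g → f ≈ₛ g
  shift-injective n {f} {g} h m = trans (≡⇒≈ (≡.sym (shift-at n f m))) (trans (h (n +ℕ m)) (≡⇒≈ (shift-at n g m)))

  shift-·ₛ : ∀ n x f → (x ·ₛ shift n f) ≈ₛ shift n (x ·ₛ f)
  shift-·ₛ zero    x f m       = refl
  shift-·ₛ (suc n) x f zero    = zeroʳ x
  shift-·ₛ (suc n) x f (suc m) = shift-·ₛ n x f m

  shift-⋆ˡ : ∀ n f g → (shift n f ⋆ g) ≈ₛ shift n (f ⋆ g)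
  shift-⋆ˡ zero    f g m    = refl
  shift-⋆ˡ (suc n) f g zero = trans (+-identityˡ _) (zeroˡ _)
  shift-⋆ˡ (suc n) f g (suc m) = begin
    Σ≤ (suc m) (λ i → shift (suc n) f i * g (suc m ∸ i)) ≈⟨ Σ<-first (suc m) _ ⟩
    0# * g (suc m) + Σ≤ m (λ i → shift n f i * g (m ∸ i)) ≈⟨ trans (+-cong (zeroˡ _) refl) (+-identityˡ _) ⟩
    (shift n f ⋆ g) m                                    ≈⟨ shift-⋆ˡ n f g m ⟩
    shift n (f ⋆ g) m                                    ∎

  shift-⋆ʳ : ∀ n f g → (f ⋆ shift n g) ≈ₛ shift n (f ⋆ g)
  shift-⋆ʳ n f g = ⋆-comm f _ ▹ shift-⋆ˡ n g f ▹ shift-cong n (⋆-comm g f)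

  shift-tail : ∀ n (f : Series) → (∀ m → m < n → f m ≈ 0#) → f ≈ₛ shift n (λ m → f (n +ℕ m))
  shift-tail zero    f h m       = refl
  shift-tail (suc n) f h zero    = h zero (s≤s z≤n)
  shift-tail (suc n) f h (suc m) = shift-tail n (f ∘ suc) (λ k k<n → h (suc k) (s≤s k<n)) m

  dilate-cong : ∀ q {f g} → f ≈ₛ g → dilate q f ≈ₛ dilate q g
  dilate-cong q h m = *-cong refl (h m)

  dilate-⋆ : ∀ q f g → dilate q (f ⋆ g) ≈ₛ (dilate q f ⋆ dilate q g)
  dilate-⋆ q f g m = trans (Σ<-*ˡ (suc m) _ _) (Σ<-cong-< (suc m) (λ i i<1+m → splitPower i (ℕₚ.≤-pred i<1+m)))
    where
    splitPower : ∀ i → i ≤ m → pow q m * (f i * g (m ∸ i)) ≈ pow q i * f i * (pow q (m ∸ i) * g (m ∸ i))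
    splitPower i i≤m = begin
      pow q m * (f i * g (m ∸ i))                 ≈⟨ *-cong (≡⇒≈ (≡.cong (pow q) (≡.sym (ℕₚ.m+[n∸m]≡n i≤m)))) refl ⟩
      pow q (i +ℕ (m ∸ i)) * (f i * g (m ∸ i))    ≈⟨ *-cong (pow-+ q i (m ∸ i)) refl ⟩
      pow q i * pow q (m ∸ i) * (f i * g (m ∸ i)) ≈⟨ solve 4 (λ a b c d → (a :* b) :* (c :* d) := (a :* c) :* (b :* d)) refl (pow q i) (pow q (m ∸ i)) (f i) (g (m ∸ i)) ⟩
      pow q i * f i * (pow q (m ∸ i) * g (m ∸ i)) ∎

  dilate-one : ∀ q → dilate q oneS ≈ₛ oneS
  dilate-one q zero    = *-identityʳ _
  dilate-one q (suc m) = zeroʳ _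

  dilate-shift : ∀ q n u → dilate q (shift n u) ≈ₛ shift n (pow q n ·ₛ dilate q u)
  dilate-shift q zero    u m       = sym (*-identityˡ _)
  dilate-shift q (suc n) u zero    = zeroʳ _
  dilate-shift q (suc n) u (suc m) = begin
    q * pow q m * shift n u m              ≈⟨ *-assoc _ _ _ ⟩
    q * (pow q m * shift n u m)            ≈⟨ *-cong refl (dilate-shift q n u m) ⟩
    q * shift n (pow q n ·ₛ dilate q u) m  ≈⟨ shift-·ₛ n q _ m ⟩
    shift n (q ·ₛ pow q n ·ₛ dilate q u) m ≈⟨ shift-cong n (λ k → sym (*-assoc _ _ _)) m ⟩
    shift n (pow q (suc n) ·ₛ dilate q u) m ∎

  module CourseOfValues (step : ℕ → (ℕ → Carrier) → Carrier)
    (step-cong : ∀ m h h′ → (∀ k → k < m → h k ≈ h′ k) → step m h ≈ step m h′) where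

    -- approx m is the correct sequence at all indices below m
    approx : ℕ → ℕ → Carrier
    approx zero    k = 0#
    approx (suc m) k with k <? m
    ... | yes _ = approx m k
    ... | no _  = step m (approx m)

    sol : ℕ → Carrier
    sol k = approx (suc k) k

    approx-top : ∀ m → approx (suc m) m ≡ step m (approx m)
    approx-top m with m <? m
    ... | yes m<m = ⊥-elim (ℕₚ.<-irrefl ≡.refl m<m)
    ... | no _    = ≡.refl

    approx-correct : ∀ m k → k < m → approx m k ≡ sol k
    approx-correct (suc m) k k<1+m with k <? m
    ... | yes k<m = approx-correct m k k<m
    ... | no k≮m with ℕₚ.≤∧≮⇒≡ (ℕₚ.≤-pred k<1+m) k≮m
    ...   | ≡.refl = ≡.sym (approx-top k)

    sol-eq : ∀ m → sol m ≈ step m sol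
    sol-eq m = trans (≡⇒≈ (approx-top m)) (step-cong m _ _ (λ k k<m → ≡⇒≈ (approx-correct m k k<m)))

  module SeriesInverse (a : Series) (y : Carrier) (a₀y≈1 : a 0 * y ≈ 1#) where
    private
      step : ℕ → (ℕ → Carrier) → Carrier
      step zero    b = y
      step (suc m) b = - (y * Σ< (suc m) (λ i → a (suc i) * b (m ∸ i)))

      step-cong : ∀ m b b′ → (∀ k → k < m → b k ≈ b′ k) → step m b ≈ step m b′
      step-cong zero    b b′ h = refl
      step-cong (suc m) b b′ h = -‿cong (*-cong refl (Σ<-cong (suc m) (λ i → *-cong refl (h (m ∸ i) (s≤s (ℕₚ.m∸n≤m m i))))))

      open CourseOfValues step step-cong

    inv : Series
    inv = sol

    inv-at-0 : inv 0 ≈ y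
    inv-at-0 = sol-eq 0

    inverseʳ : (a ⋆ inv) ≈ₛ oneS
    inverseʳ zero    = trans (⋆-at-0 a inv) (trans (*-cong refl inv-at-0) a₀y≈1)
    inverseʳ (suc m) = begin
      Σ≤ (suc m) (λ i → a i * inv (suc m ∸ i)) ≈⟨ Σ<-first (suc m) _ ⟩
      a 0 * inv (suc m) + S                    ≈⟨ +-cong (*-cong refl (sol-eq (suc m))) refl ⟩
      a 0 * - (y * S) + S                      ≈⟨ +-cong (sym (-‿distribʳ-* _ _)) refl ⟩
      - (a 0 * (y * S)) + S                    ≈⟨ +-cong (-‿cong (trans (sym (*-assoc _ _ _)) (trans (*-cong a₀y≈1 refl) (*-identityˡ S)))) refl ⟩
      - S + S                                  ≈⟨ -‿inverseˡ S ⟩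
      0#                                       ∎
      where
      S : Carrier
      S = Σ< (suc m) (λ i → a (suc i) * inv (m ∸ i))

  evalL-zeros : ∀ xs x → (∀ j → coeffL xs j ≈ 0#) → evalL xs x ≈ 0#
  evalL-zeros []       x h = refl
  evalL-zeros (y ∷ ys) x h =
    trans (+-cong (h 0) (trans (*-cong refl (evalL-zeros ys x (h ∘ suc))) (zeroʳ x))) (+-identityʳ 0#)

  evalL-cong : ∀ xs ys x → (∀ j → coeffL xs j ≈ coeffL ys j) → evalL xs x ≈ evalL ys x
  evalL-cong []       ys       x h = sym (evalL-zeros ys x (λ j → sym (h j)))
  evalL-cong (y ∷ ys) []       x h = evalL-zeros (y ∷ ys) x h
  evalL-cong (y ∷ ys) (z ∷ zs) x h = +-cong (h 0) (*-cong refl (evalL-cong ys zs x (h ∘ suc)))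

  tCoeff-list : ∀ j → tCoeff 0 j ≈ coeffL (0# ∷ 1# ∷ []) j
  tCoeff-list zero          = refl
  tCoeff-list (suc zero)    = refl
  tCoeff-list (suc (suc j)) = refl

  evalL-t : ∀ xs x → (∀ j → coeffL xs j ≈ tCoeff 0 j) → evalL xs x ≈ x
  evalL-t xs x h = begin
    evalL xs x             ≈⟨ evalL-cong xs (0# ∷ 1# ∷ []) x (λ j → trans (h j) (tCoeff-list j)) ⟩
    0# + x * (1# + x * 0#) ≈⟨ +-identityˡ _ ⟩
    x * (1# + x * 0#)      ≈⟨ *-cong refl (trans (+-cong refl (zeroʳ x)) (+-identityʳ 1#)) ⟩
    x * 1#                 ≈⟨ *-identityʳ x ⟩
    x                      ∎

  evalL-split : ∀ xs x → evalL xs x ≈ coeffL xs 0 + Σ< (length xs) (λ j → coeffL xs (suc j) * pow x (suc j))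
  evalL-split []       x = sym (+-identityʳ 0#)
  evalL-split (y ∷ ys) x = +-cong refl (begin
    x * evalL ys x
      ≈⟨ *-cong refl (evalL-split ys x) ⟩
    x * (coeffL ys 0 + Σ< L (λ j → coeffL ys (suc j) * pow x (suc j)))
      ≈⟨ distribˡ x _ _ ⟩
    x * coeffL ys 0 + x * Σ< L (λ j → coeffL ys (suc j) * pow x (suc j))
      ≈⟨ +-cong (solve 2 (λ x c → x :* c := c :* (x :* con 1)) refl x (coeffL ys 0)) (Σ<-*ˡ L x _) ⟩
    coeffL ys 0 * (x * 1#) + Σ< L (λ j → x * (coeffL ys (suc j) * pow x (suc j)))
      ≈⟨ +-cong refl (Σ<-cong L (λ j → solve 3 (λ x c p → x :* (c :* p) := c :* (x :* p)) refl x (coeffL ys (suc j)) (pow x (suc j)))) ⟩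
    coeffL ys 0 * pow x 1 + Σ< L (λ j → coeffL ys (suc j) * pow x (suc (suc j)))
      ≈⟨ sym (Σ<-first L (λ j → coeffL ys j * pow x (suc j))) ⟩
    Σ< (suc L) (λ j → coeffL ys j * pow x (suc j)) ∎)
    where
    L : ℕ
    L = length ys

  -- geometric sums  G_j(s,t) = Σ_{b≤j} t^{j-b} s^b = (s^{j+1} - t^{j+1}) / (s - t)
  geomSum : Carrier → Carrier → ℕ → Carrier
  geomSum s t j = Σ≤ j (λ b → pow t (j ∸ b) * pow s b)

  geomSum-0 : ∀ s t → geomSum s t 0 ≈ 1#
  geomSum-0 s t = trans (+-identityˡ _) (*-identityˡ _)

  geomSum-suc : ∀ s t j → geomSum s t (suc j) ≈ t * geomSum s t j + pow s (suc j)
  geomSum-suc s t j = +-cong (trans (Σ<-cong-< (suc j) lowerTerm) (sym (Σ<-*ˡ (suc j) t _))) topTerm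
    where
    lowerTerm : ∀ b → b < suc j → pow t (suc j ∸ b) * pow s b ≈ t * (pow t (j ∸ b) * pow s b)
    lowerTerm b (s≤s b≤j) rewrite ℕₚ.+-∸-assoc 1 b≤j = *-assoc _ _ _
    topTerm : pow t (j ∸ j) * pow s (suc j) ≈ pow s (suc j)
    topTerm rewrite ℕₚ.n∸n≡0 j = *-identityˡ _

  -- (s - t) G_j(s,t) = s^{j+1} - t^{j+1}, written without subtraction
  geomSum-identity : ∀ s t j → s * geomSum s t j + pow t (suc j) ≈ t * geomSum s t j + pow s (suc j)
  geomSum-identity s t zero = begin
    s * geomSum s t 0 + t * 1# ≈⟨ +-cong (*-cong refl (geomSum-0 s t)) refl ⟩
    s * 1# + t * 1#            ≈⟨ +-comm _ _ ⟩
    t * 1# + s * 1#            ≈⟨ +-cong (*-cong refl (sym (geomSum-0 s t))) refl ⟩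
    t * geomSum s t 0 + s * 1# ∎
  geomSum-identity s t (suc j) = begin
    s * geomSum s t (suc j) + t * Tⱼ ≈⟨ +-cong (*-cong refl (geomSum-suc s t j)) refl ⟩
    s * (t * G + Sⱼ) + t * Tⱼ        ≈⟨ solve 5 (λ s t G S T → s :* (t :* G :+ S) :+ t :* T := t :* (s :* G :+ T) :+ s :* S) refl s t G Sⱼ Tⱼ ⟩
    t * (s * G + Tⱼ) + s * Sⱼ        ≈⟨ +-cong (*-cong refl (geomSum-identity s t j)) refl ⟩
    t * (t * G + Sⱼ) + s * Sⱼ        ≈⟨ +-cong (*-cong refl (sym (geomSum-suc s t j))) refl ⟩
    t * geomSum s t (suc j) + s * Sⱼ ∎
    where
    G Sⱼ Tⱼ : Carrier
    G  = geomSum s t j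
    Sⱼ = pow s (suc j)
    Tⱼ = pow t (suc j)

  Σ<-weighted : ∀ L s t (w G T S : ℕ → Carrier) → (∀ j → s * G j + T j ≈ t * G j + S j) →
    s * Σ< L (λ j → w j * G j) + Σ< L (λ j → w j * T j) ≈ t * Σ< L (λ j → w j * G j) + Σ< L (λ j → w j * S j)
  Σ<-weighted zero    s t w G T S h = trans (+-cong (zeroʳ s) refl) (sym (+-cong (zeroʳ t) refl))
  Σ<-weighted (suc L) s t w G T S h = begin
    s * (ΣG + w L * G L) + (ΣT + w L * T L)
      ≈⟨ solve 6 (λ s Q c g A T → s :* (Q :+ c :* g) :+ (A :+ c :* T) := (s :* Q :+ A) :+ c :* (s :* g :+ T)) refl s ΣG (w L) (G L) ΣT (T L) ⟩
    (s * ΣG + ΣT) + w L * (s * G L + T L)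
      ≈⟨ +-cong (Σ<-weighted L s t w G T S h) (*-cong refl (h L)) ⟩
    (t * ΣG + ΣS) + w L * (t * G L + S L)
      ≈⟨ solve 6 (λ t Q c g A S → (t :* Q :+ A) :+ c :* (t :* g :+ S) := t :* (Q :+ c :* g) :+ (A :+ c :* S)) refl t ΣG (w L) (G L) ΣS (S L) ⟩
    t * (ΣG + w L * G L) + (ΣS + w L * S L) ∎
    where
    ΣG ΣT ΣS : Carrier
    ΣG = Σ< L (λ j → w j * G j)
    ΣT = Σ< L (λ j → w j * T j)
    ΣS = Σ< L (λ j → w j * S j)

  -- the divided difference (p(s) - p(t)) / (s - t) of the polynomial xs
  divDiff : List Carrier → Carrier → Carrier → Carrier
  divDiff xs s t = Σ< (length xs) (λ j → coeffL xs (suc j) * geomSum s t j)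

  divDiff-identity : ∀ xs s t → s * divDiff xs s t + evalL xs t ≈ t * divDiff xs s t + evalL xs s
  divDiff-identity xs s t = begin
    s * Δ + evalL xs t ≈⟨ +-cong refl (evalL-split xs t) ⟩
    s * Δ + (c₀ + Σt)  ≈⟨ solve 4 (λ s Δ c A → s :* Δ :+ (c :+ A) := c :+ (s :* Δ :+ A)) refl s Δ c₀ Σt ⟩
    c₀ + (s * Δ + Σt)  ≈⟨ +-cong refl (Σ<-weighted (length xs) s t (coeffL xs ∘ suc) (geomSum s t) (pow t ∘ suc) (pow s ∘ suc) (geomSum-identity s t)) ⟩
    c₀ + (t * Δ + Σs)  ≈⟨ solve 4 (λ t Δ c A → c :+ (t :* Δ :+ A) := t :* Δ :+ (c :+ A)) refl t Δ c₀ Σs ⟩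
    t * Δ + (c₀ + Σs)  ≈⟨ +-cong refl (sym (evalL-split xs s)) ⟩
    t * Δ + evalL xs s ∎
    where
    Δ c₀ Σt Σs : Carrier
    Δ  = divDiff xs s t
    c₀ = coeffL xs 0
    Σt = Σ< (length xs) (λ j → coeffL xs (suc j) * pow t (suc j))
    Σs = Σ< (length xs) (λ j → coeffL xs (suc j) * pow s (suc j))

  divDiff-t : ∀ xs s t → (∀ j → coeffL xs j ≈ tCoeff 0 j) → divDiff xs s t ≈ 1#
  divDiff-t []       s t h = ⊥-elim (0≉1 (h 1))
  divDiff-t (y ∷ ys) s t h = begin
    Σ< (suc (length ys)) (λ j → coeffL ys j * geomSum s t j)
      ≈⟨ Σ<-first (length ys) _ ⟩
    coeffL ys 0 * geomSum s t 0 + Σ< (length ys) (λ j → coeffL ys (suc j) * geomSum s t (suc j))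
      ≈⟨ +-cong (*-cong (h 1) (geomSum-0 s t)) (Σ<-zero (length ys) (λ j _ → trans (*-cong (h (2 +ℕ j)) refl) (zeroˡ _))) ⟩
    1# * 1# + 0#
      ≈⟨ trans (+-identityʳ _) (*-identityˡ 1#) ⟩
    1# ∎

  ΔPseries : ZTSeries → Carrier → Carrier → Series
  ΔPseries P s t a = Σ< (length (P a)) (λ j → Σ≤ j (λ b → ΔPcoeff P a b (j ∸ b) * pow t (j ∸ b) * pow s b))

  ΔPseries-divDiff : ∀ P s t a → ΔPseries P s t a ≈ divDiff (P a) s t
  ΔPseries-divDiff P s t a = Σ<-cong (length (P a)) (λ j →
    trans (Σ<-cong-< (suc j) (λ b b<1+j → trans (*-assoc _ _ _) (*-cong (coeffIndex j b (ℕₚ.≤-pred b<1+j)) refl)))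
          (sym (Σ<-*ˡ (suc j) _ _)))
    where
    coeffIndex : ∀ j b → b ≤ j → ΔPcoeff P a b (j ∸ b) ≈ coeffL (P a) (suc j)
    coeffIndex j b b≤j = ≡⇒≈ (≡.cong (λ i → coeffL (P a) (suc i)) (ℕₚ.m+[n∸m]≡n b≤j))

  ΔP-identity : ∀ P s t → ((s ·ₛ ΔPseries P s t) +ₛ evalAt P t) ≈ₛ ((t ·ₛ ΔPseries P s t) +ₛ evalAt P s)
  ΔP-identity P s t a = begin
    s * ΔPseries P s t a + evalL (P a) t  ≈⟨ +-cong (*-cong refl (ΔPseries-divDiff P s t a)) refl ⟩
    s * divDiff (P a) s t + evalL (P a) t ≈⟨ divDiff-identity (P a) s t ⟩
    t * divDiff (P a) s t + evalL (P a) s ≈⟨ +-cong (*-cong refl (sym (ΔPseries-divDiff P s t a))) refl ⟩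
    t * ΔPseries P s t a + evalL (P a) s  ∎

  module QCatalanBasis
    (q : Carrier) (pow-injective : ∀ j k → pow q j ≈ pow q k → j ≡ k)
    (P : ZTSeries) (catalan : Catalan P)
    (e : ℕ → Series) (e≉0 : ∀ k → ¬ (e k ≈ₛ zeroS))
    (q-catalan : ∀ k → (dilate q (e k) ⋆ evalAt P 1#) ≈ₛ (evalAt P (pow q k) ⋆ e k))
    where

    P₁ : Series
    P₁ = evalAt P 1#

    pow-distinct : ∀ j k → ¬ (j ≡ k) → ¬ (pow q j ≈ pow q k)
    pow-distinct j k j≢k h = j≢k (pow-injective j k h)

    pow≉0 : ∀ k → ¬ (pow q k ≈ 0#)
    pow≉0 k qᵏ≈0 = ℕₚ.1+n≢n (≡.sym (pow-injective k (suc k) (trans qᵏ≈0 (sym qᵏ⁺¹≈0))))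
      where
      qᵏ⁺¹≈0 : pow q (suc k) ≈ 0#
      qᵏ⁺¹≈0 = trans (*-cong refl qᵏ≈0) (zeroʳ q)

    -- P(0,t) = t, the only part of the Catalan condition that is needed
    catalan-at-0 : ∀ j → coeffL (P 0) j ≈ tCoeff 0 j
    catalan-at-0 j = trans (proj₂ catalan 0 j) (trans (+-cong refl -0#≈0#) (+-identityʳ _))

    P-at-0 : ∀ x → evalAt P x 0 ≈ x
    P-at-0 x = evalL-t (P 0) x catalan-at-0

    ΔP-at-0 : ∀ s t → ΔPseries P s t 0 ≈ 1#
    ΔP-at-0 s t = trans (ΔPseries-divDiff P s t 0) (divDiff-t (P 0) s t catalan-at-0)

    -- Comparing the coefficients of z^m in the q-Catalan equation:
    -- if e_k vanishes below m then q^m e_k(m) = q^k e_k(m).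
    leading-coefficient : ∀ k m → (∀ i → i < m → e k i ≈ 0#) → pow q m * e k m ≈ pow q k * e k m
    leading-coefficient k m h = begin
      pow q m * e k m              ≈⟨ sym (trans (*-cong refl (P-at-0 1#)) (*-identityʳ _)) ⟩
      pow q m * e k m * P₁ 0       ≈⟨ sym (⋆-at-orderˡ m (dilate q (e k)) P₁ (λ i i<m → trans (*-cong refl (h i i<m)) (zeroʳ _))) ⟩
      (dilate q (e k) ⋆ P₁) m      ≈⟨ q-catalan k m ⟩
      (evalAt P (pow q k) ⋆ e k) m ≈⟨ ⋆-at-orderʳ m (e k) (evalAt P (pow q k)) h ⟩
      evalAt P (pow q k) 0 * e k m ≈⟨ *-cong (P-at-0 _) refl ⟩
      pow q k * e k m              ∎

    vanishing : ∀ k m → (∀ i → i < m → i ≡ k → e k i ≈ 0#) → ∀ i → i < m → e k i ≈ 0#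
    vanishing k (suc m) at-k i (s≤s i≤m) with ℕₚ.m≤n⇒m<n∨m≡n i≤m
    ... | inj₁ i<m    = vanishing k m (λ j j<m → at-k j (ℕₚ.m<n⇒m<1+n j<m)) i i<m
    ... | inj₂ ≡.refl with i ℕ.≟ k
    ...   | yes i≡k = at-k i ℕₚ.≤-refl i≡k
    ...   | no i≢k  = *-cancel-≉ (e k i) (pow-distinct i k i≢k)
                        (leading-coefficient k i (vanishing k i (λ j j<i → at-k j (ℕₚ.m<n⇒m<1+n j<i))))

    order-below : ∀ k m → m < k → e k m ≈ 0#
    order-below k m m<k = vanishing k (suc m) (λ { i (s≤s i≤m) ≡.refl → ⊥-elim (ℕₚ.<⇒≱ m<k i≤m) }) m ℕₚ.≤-refl

    order-exact : ∀ k → ¬ (e k k ≈ 0#)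
    order-exact k eₖₖ≈0 = e≉0 k (λ m → vanishing k (suc m) (λ { i _ ≡.refl → eₖₖ≈0 }) m ℕₚ.≤-refl)

    -- Every series has coordinates in the basis (e_k), found by triangular
    -- elimination: c_m = (f m - Σ_{k<m} c_k e_k(m)) / e_m(m).
    module Coordinates (f : Series) where
      private
        eₘₘ⁻¹ : ℕ → Carrier
        eₘₘ⁻¹ m = proj₁ (inverse (e m m) (order-exact m))

        step : ℕ → (ℕ → Carrier) → Carrier
        step m c = (f m - Σ< m (λ k → c k * e k m)) * eₘₘ⁻¹ m

        step-cong : ∀ m c c′ → (∀ k → k < m → c k ≈ c′ k) → step m c ≈ step m c′
        step-cong m c c′ h = *-cong (+-cong refl (-‿cong (Σ<-cong-< m (λ k k<m → *-cong (h k k<m) refl)))) refl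

      open CourseOfValues step step-cong using (sol; sol-eq)

      coords : Coords e f sol
      coords m = sym (begin
        Σ< m (λ k → sol k * e k m) + sol m * e m m ≈⟨ +-cong refl (*-cong (sol-eq m) refl) ⟩
        S + (f m - S) * eₘₘ⁻¹ m * e m m            ≈⟨ +-cong refl (*-assoc _ _ _) ⟩
        S + (f m - S) * (eₘₘ⁻¹ m * e m m)          ≈⟨ +-cong refl (*-cong refl (trans (*-comm _ _) (proj₂ (inverse (e m m) (order-exact m))))) ⟩
        S + (f m - S) * 1#                         ≈⟨ +-cong refl (*-identityʳ _) ⟩
        S + (f m - S)                              ≈⟨ x+[y-x]≈y S (f m) ⟩
        f m                                        ∎)
        where
        S : Carrier
        S = Σ< m (λ k → sol k * e k m)

      coordinates-exist : ∃ λ cs → Coords e f cs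
      coordinates-exist = sol , coords

    Tpow-truncate : ∀ n cs b m → m ≤ n → Tpow e q cs b m ≈ Σ≤ n (λ k → cs k * pow (pow q k) b * e k m)
    Tpow-truncate n cs b m m≤n = Σ<-extend (suc m) (suc n) _ (s≤s m≤n)
      (λ k m<k _ → trans (*-cong refl (order-below k m m<k)) (zeroʳ _))

    module DualForm (n : ℕ) where
      t : Carrier
      t = pow q n

      u : Series
      u m = e n (n +ℕ m)

      e-split : e n ≈ₛ shift n u
      e-split = shift-tail n (e n) (order-below n)

      u₀≉0 : ¬ (u 0 ≈ 0#)
      u₀≉0 u₀≈0 = order-exact n (trans (≡⇒≈ (≡.cong (e n) (≡.sym (ℕₚ.+-identityʳ n)))) u₀≈0)

      -- v = u⁻¹ and P(z,1)⁻¹ exist since u(0) ≠ 0 and P(0,1) = 1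
      module U⁻¹ = SeriesInverse u (proj₁ (inverse (u 0) u₀≉0)) (proj₂ (inverse (u 0) u₀≉0))
      module P₁⁻¹ = SeriesInverse P₁ 1# (trans (*-identityʳ _) (P-at-0 1#))

      v : Series
      v = U⁻¹.inv

      D : Series
      D = dilate q (e n) ⋆ P₁

      W : Series
      W = dilate q v ⋆ P₁⁻¹.inv

      dilate-uv : (dilate q u ⋆ dilate q v) ≈ₛ oneS
      dilate-uv = ≈ₛ-sym (dilate-⋆ q u v) ▹ dilate-cong q U⁻¹.inverseʳ ▹ dilate-one q

      W-inverse : ((dilate q u ⋆ P₁) ⋆ W) ≈ₛ oneS
      W-inverse = ⋆-Solver.solve 4 (λ a b c d → (a ⊕ b) ⊕ (c ⊕ d) ⊜ (a ⊕ c) ⊕ (b ⊕ d)) ≈ₛ-refl (dilate q u) P₁ (dilate q v) P₁⁻¹.inv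
                ▹ ⋆-cong dilate-uv P₁⁻¹.inverseʳ ▹ ⋆-identityʳ oneS
        where open ⋆-Solver using (_⊕_; _⊜_)

      D-split : D ≈ₛ shift n (t ·ₛ (dilate q u ⋆ P₁))
      D-split = ⋆-cong (dilate-cong q e-split ▹ dilate-shift q n u) (≈ₛ-refl {P₁})
              ▹ shift-⋆ˡ n (t ·ₛ dilate q u) P₁ ▹ shift-cong n (⋆-*ˡ t (dilate q u) P₁)

      -- D W = q^n z^n: division by D is multiplication by W, up to q^n z^n
      D⋆W : (D ⋆ W) ≈ₛ shift n (t ·ₛ oneS)
      D⋆W = ⋆-cong D-split (≈ₛ-refl {W}) ▹ shift-⋆ˡ n (t ·ₛ (dilate q u ⋆ P₁)) W
          ▹ shift-cong n (⋆-*ˡ t (dilate q u ⋆ P₁) W ▹ ·ₛ-cong t W-inverse)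

      -- the q-Catalan equation for k = n, divided by z^n
      q-catalan-tail : (evalAt P t ⋆ u) ≈ₛ (t ·ₛ (dilate q u ⋆ P₁))
      q-catalan-tail = shift-injective n
        (≈ₛ-sym (shift-⋆ʳ n (evalAt P t) u) ▹ ⋆-cong (≈ₛ-refl {evalAt P t}) (≈ₛ-sym e-split) ▹ ≈ₛ-sym (q-catalan n)
         ▹ D-split)

      P-t⋆W : (evalAt P t ⋆ W) ≈ₛ (t ·ₛ v)
      P-t⋆W = ≈ₛ-sym (⋆-identityʳ (evalAt P t ⋆ W)) ▹ ⋆-cong (≈ₛ-refl {evalAt P t ⋆ W}) (≈ₛ-sym U⁻¹.inverseʳ)
            ▹ ⋆-Solver.solve 4 (λ p w u′ v′ → (p ⊕ w) ⊕ (u′ ⊕ v′) ⊜ (p ⊕ u′) ⊕ (w ⊕ v′)) ≈ₛ-refl (evalAt P t) W u v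
            ▹ ⋆-cong q-catalan-tail (≈ₛ-refl {W ⋆ v})
            ▹ ⋆-*ˡ t (dilate q u ⋆ P₁) (W ⋆ v) ▹ ·ₛ-cong t (⋆-Solver.solve 3 (λ a w v′ → a ⊕ (w ⊕ v′) ⊜ (a ⊕ w) ⊕ v′) ≈ₛ-refl (dilate q u ⋆ P₁) W v
                                    ▹ ⋆-cong W-inverse (≈ₛ-refl {v}) ▹ ⋆-identityˡ v)
        where open ⋆-Solver using (_⊕_; _⊜_)

      -- multiplying the two sides of the q-Catalan equation by e_k W
      P-qᵏ⋆eW : ∀ k → (evalAt P (pow q k) ⋆ (e k ⋆ W)) ≈ₛ dilate q (e k ⋆ v)
      P-qᵏ⋆eW k = ≈ₛ-sym (⋆-assoc (evalAt P (pow q k)) (e k) W) ▹ ⋆-cong (≈ₛ-sym (q-catalan k)) (≈ₛ-refl {W})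
                ▹ ⋆-Solver.solve 4 (λ a b c d → (a ⊕ b) ⊕ (c ⊕ d) ⊜ (a ⊕ c) ⊕ (b ⊕ d)) ≈ₛ-refl (dilate q (e k)) P₁ (dilate q v) P₁⁻¹.inv
                ▹ ⋆-cong (≈ₛ-sym (dilate-⋆ q (e k) v)) P₁⁻¹.inverseʳ ▹ ⋆-identityʳ (dilate q (e k ⋆ v))
        where open ⋆-Solver using (_⊕_; _⊜_)

      P-t⋆eW : ∀ k → (evalAt P t ⋆ (e k ⋆ W)) ≈ₛ (t ·ₛ (e k ⋆ v))
      P-t⋆eW k = ⋆-Solver.solve 3 (λ p a w → p ⊕ (a ⊕ w) ⊜ a ⊕ (p ⊕ w)) ≈ₛ-refl (evalAt P t) (e k) W
               ▹ ⋆-cong (≈ₛ-refl {e k}) P-t⋆W ▹ ⋆-*ʳ t (e k) v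
        where open ⋆-Solver using (_⊕_; _⊜_)

      -- Q k = ΔP(z, q^k, q^n), the series by which T^b acts on e_k
      Q : ℕ → Series
      Q k = ΔPseries P (pow q k) t

      orthogonal : ∀ k → ¬ (k ≡ n) → (Q k ⋆ (e k ⋆ W)) n ≈ 0#
      orthogonal k k≢n = *-cancel-≉ X (pow-distinct k n k≢n) (+-cancelʳ (t * Y) _ _ (begin
        s * X + t * Y                            ≈⟨ +-cong refl (sym (P-t⋆eW k n)) ⟩
        s * X + (evalAt P t ⋆ E) n               ≈⟨ sym (⋆-affine s (Q k) (evalAt P t) E n) ⟩
        (((s ·ₛ Q k) +ₛ evalAt P t) ⋆ E) n       ≈⟨ ⋆-cong (ΔP-identity P s t) (≈ₛ-refl {E}) n ⟩
        (((t ·ₛ Q k) +ₛ evalAt P s) ⋆ E) n       ≈⟨ ⋆-affine t (Q k) (evalAt P s) E n ⟩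
        t * X + (evalAt P s ⋆ E) n               ≈⟨ +-cong refl (P-qᵏ⋆eW k n) ⟩
        t * X + t * Y                            ∎))
        where
        s X Y : Carrier
        E : Series
        s = pow q k
        E = e k ⋆ W
        X = (Q k ⋆ E) n
        Y = (e k ⋆ v) n

      normalised : (Q n ⋆ (e n ⋆ W)) n ≈ 1#
      normalised = begin
        (Q n ⋆ (e n ⋆ W)) n              ≈⟨ (⋆-cong (≈ₛ-refl {Q n}) (⋆-cong e-split (≈ₛ-refl {W}) ▹ shift-⋆ˡ n u W) ▹ shift-⋆ʳ n (Q n) (u ⋆ W)) n ⟩
        shift n (Q n ⋆ (u ⋆ W)) n        ≈⟨ ≡⇒≈ (shift-at-n n (Q n ⋆ (u ⋆ W))) ⟩
        (Q n ⋆ (u ⋆ W)) 0                ≈⟨ trans (⋆-at-0 (Q n) (u ⋆ W)) (*-cong refl (trans (⋆-at-0 u W) (*-cong refl (⋆-at-0 (dilate q v) P₁⁻¹.inv)))) ⟩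
        Q n 0 * (u 0 * ((1# * v 0) * P₁⁻¹.inv 0))
                                         ≈⟨ *-cong (ΔP-at-0 _ _) (*-cong refl (*-cong (*-identityˡ _) P₁⁻¹.inv-at-0)) ⟩
        1# * (u 0 * (v 0 * 1#))          ≈⟨ trans (*-identityˡ _) (*-cong refl (*-identityʳ _)) ⟩
        u 0 * v 0                        ≈⟨ trans (*-cong refl U⁻¹.inv-at-0) (proj₂ (inverse (u 0) u₀≉0)) ⟩
        1#                               ∎

      module Applied (cs : ℕ → Carrier) where
        g : Series
        g = ΔPop P e q cs n

        -- The z^a-part of ΔP(z,T,q^n) applied to f, at degree m′ ≤ n: since T^b
        -- acts on e_k by (q^k)^b, it becomes Σ_{k≤n} c_k [z^a]ΔP(z,q^k,q^n) e_k(m′).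
        ΔP-part : ∀ a m′ → m′ ≤ n →
          Σ< (length (P a)) (λ j → Σ≤ j (λ b → ΔPcoeff P a b (j ∸ b) * pow t (j ∸ b) * Tpow e q cs b m′))
            ≈ Σ≤ n (λ k → cs k * (Q k a * e k m′))
        ΔP-part a m′ m′≤n = begin
          Σ< L (λ j → Σ≤ j (λ b → A j b * Tpow e q cs b m′))
            ≈⟨ Σ<-cong L (λ j → Σ<-cong (suc j) (λ b → trans (*-cong refl (Tpow-truncate n cs b m′ m′≤n)) (Σ<-*ˡ (suc n) _ _))) ⟩
          Σ< L (λ j → Σ≤ j (λ b → Σ≤ n (λ k → A j b * B k b)))
            ≈⟨ Σ<-cong L (λ j → Σ<-swap (suc j) (suc n) _) ⟩
          Σ< L (λ j → Σ≤ n (λ k → Σ≤ j (λ b → A j b * B k b)))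
            ≈⟨ Σ<-swap L (suc n) _ ⟩
          Σ≤ n (λ k → Σ< L (λ j → Σ≤ j (λ b → A j b * B k b)))
            ≈⟨ Σ<-cong (suc n) factor ⟩
          Σ≤ n (λ k → cs k * (Q k a * e k m′)) ∎
          where
          L : ℕ
          L = length (P a)
          A : ℕ → ℕ → Carrier
          A j b = ΔPcoeff P a b (j ∸ b) * pow t (j ∸ b)
          B : ℕ → ℕ → Carrier
          B k b = cs k * pow (pow q k) b * e k m′
          factor : ∀ k → Σ< L (λ j → Σ≤ j (λ b → A j b * B k b)) ≈ cs k * (Q k a * e k m′)
          factor k = begin
            Σ< L (λ j → Σ≤ j (λ b → A j b * B k b))
              ≈⟨ Σ<-cong L (λ j → Σ<-cong (suc j) (λ b → solve 4 (λ x c p E → x :* (c :* p :* E) := (x :* p) :* (c :* E)) refl (A j b) (cs k) (pow (pow q k) b) (e k m′))) ⟩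
            Σ< L (λ j → Σ≤ j (λ b → A j b * pow (pow q k) b * (cs k * e k m′)))
              ≈⟨ Σ<-cong L (λ j → sym (Σ<-*ʳ (suc j) (cs k * e k m′) _)) ⟩
            Σ< L (λ j → Σ≤ j (λ b → A j b * pow (pow q k) b) * (cs k * e k m′))
              ≈⟨ sym (Σ<-*ʳ L (cs k * e k m′) _) ⟩
            Q k a * (cs k * e k m′)
              ≈⟨ solve 3 (λ Q c E → Q :* (c :* E) := c :* (Q :* E)) refl (Q k a) (cs k) (e k m′) ⟩
            cs k * (Q k a * e k m′) ∎

        decomposition : ∀ m → m ≤ n → g m ≈ Σ≤ n (λ k → cs k * (Q k ⋆ e k) m)
        decomposition m m≤n = begin
          g m
            ≈⟨ Σ<-cong (suc m) (λ a → ΔP-part a (m ∸ a) (ℕₚ.≤-trans (ℕₚ.m∸n≤m m a) m≤n)) ⟩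
          Σ≤ m (λ a → Σ≤ n (λ k → cs k * (Q k a * e k (m ∸ a))))
            ≈⟨ Σ<-swap (suc m) (suc n) _ ⟩
          Σ≤ n (λ k → Σ≤ m (λ a → cs k * (Q k a * e k (m ∸ a))))
            ≈⟨ Σ<-cong (suc n) (λ k → sym (Σ<-*ˡ (suc m) (cs k) _)) ⟩
          Σ≤ n (λ k → cs k * (Q k ⋆ e k) m) ∎

        coefficient : (g ⋆ W) n ≈ cs n
        coefficient = begin
          Σ≤ n (λ i → g i * W (n ∸ i))
            ≈⟨ Σ<-cong-< (suc n) (λ i i<1+n → *-cong (decomposition i (ℕₚ.≤-pred i<1+n)) refl) ⟩
          Σ≤ n (λ i → Σ≤ n (λ k → cs k * (Q k ⋆ e k) i) * W (n ∸ i))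
            ≈⟨ Σ<-cong (suc n) (λ i → trans (Σ<-*ʳ (suc n) _ _) (Σ<-cong (suc n) (λ k → *-assoc _ _ _))) ⟩
          Σ≤ n (λ i → Σ≤ n (λ k → cs k * ((Q k ⋆ e k) i * W (n ∸ i))))
            ≈⟨ Σ<-swap (suc n) (suc n) _ ⟩
          Σ≤ n (λ k → Σ≤ n (λ i → cs k * ((Q k ⋆ e k) i * W (n ∸ i))))
            ≈⟨ Σ<-cong (suc n) (λ k → trans (sym (Σ<-*ˡ (suc n) (cs k) _)) (*-cong refl (⋆-assoc (Q k) (e k) W n))) ⟩
          Σ< n (λ k → cs k * (Q k ⋆ (e k ⋆ W)) n) + cs n * (Q n ⋆ (e n ⋆ W)) n
            ≈⟨ +-cong (Σ<-zero n (λ k k<n → trans (*-cong refl (orthogonal k (ℕₚ.<⇒≢ k<n))) (zeroʳ _))) (*-cong refl normalised) ⟩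
          0# + cs n * 1#
            ≈⟨ trans (+-identityˡ _) (*-identityʳ _) ⟩
          cs n ∎

        t⁻¹ : Carrier
        t⁻¹ = proj₁ (inverse t (pow≉0 n))

        H₀ : Series
        H₀ = t⁻¹ ·ₛ (g ⋆ W)

        H₀-solution : (H₀ ⋆ D) ≈ₛ shift n g
        H₀-solution =
          ⋆-*ˡ t⁻¹ (g ⋆ W) D
          ▹ ·ₛ-cong t⁻¹ (⋆-assoc g W D ▹ ⋆-cong (≈ₛ-refl {g}) (⋆-comm W D ▹ D⋆W) ▹ shift-⋆ʳ n g (t ·ₛ oneS)
                         ▹ shift-cong n (⋆-*ʳ t g oneS ▹ ·ₛ-cong t (⋆-identityʳ g)))
          ▹ shift-·ₛ n t⁻¹ (t ·ₛ g)
          ▹ shift-cong n (λ m → trans (sym (*-assoc _ _ _)) (trans (*-cong t⁻¹t≈1 refl) (*-identityˡ _)))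
          where
          t⁻¹t≈1 : t⁻¹ * t ≈ 1#
          t⁻¹t≈1 = trans (*-comm _ _) (proj₂ (inverse t (pow≉0 n)))

        solution-determines : ∀ N H → (H ⋆ D) ≈ₛ shift N g → cs n ≈ t * H N
        solution-determines N H HD≈zᴺg = begin
          cs n                        ≈⟨ sym coefficient ⟩
          (g ⋆ W) n                   ≈⟨ ≡⇒≈ (≡.sym (shift-at N (g ⋆ W) n)) ⟩
          shift N (g ⋆ W) (N +ℕ n)    ≈⟨ sym (multiplied-by-W (N +ℕ n)) ⟩
          shift n (t ·ₛ H) (N +ℕ n)   ≈⟨ ≡⇒≈ (≡.cong (shift n (t ·ₛ H)) (ℕₚ.+-comm N n)) ⟩
          shift n (t ·ₛ H) (n +ℕ N)   ≈⟨ ≡⇒≈ (shift-at n (t ·ₛ H) N) ⟩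
          t * H N                     ∎
          where
          multiplied-by-W : shift n (t ·ₛ H) ≈ₛ shift N (g ⋆ W)
          multiplied-by-W =
            shift-cong n (≈ₛ-sym (⋆-*ʳ t H oneS ▹ ·ₛ-cong t (⋆-identityʳ H)))
            ▹ ≈ₛ-sym (shift-⋆ʳ n H (t ·ₛ oneS)) ▹ ⋆-cong (≈ₛ-refl {H}) (≈ₛ-sym D⋆W) ▹ ≈ₛ-sym (⋆-assoc H D W)
            ▹ ⋆-cong HD≈zᴺg (≈ₛ-refl {W}) ▹ shift-⋆ˡ N g W

theorem4p6p1 : ∀ {c ℓ} (F : Field c ℓ) → 
    let open Field F
        open FieldOps F
    in
    (q : Carrier) → (∀ j k → pow q j ≈ pow q k → j ≡ k) →
    (P : ZTSeries) → Catalan P →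
    (e : ℕ → Series) → (∀ k → ¬ (e k ≈ₛ zeroS)) →
    (∀ k → (dilate q (e k) ⋆ evalAt P 1#) ≈ₛ (evalAt P (pow q k) ⋆ e k)) →
    ∀ (n : ℕ) (f : Series) →
      (∃ λ cs → Coords e f cs) ×
      (∀ cs → Coords e f cs →
        let D = dilate q (e n) ⋆ evalAt P 1#
            g = ΔPop P e q cs n
        in (∃ λ N → ∃ λ H → (H ⋆ D) ≈ₛ shift N g) ×
           (∀ N H → (H ⋆ D) ≈ₛ shift N g → cs n ≈ pow q n * H N))
theorem4p6p1 F q pow-injective P catalan e e≉0 q-catalan n f =
  coordinates-exist , λ cs _ → let open Applied cs in (n , H₀ , H₀-solution) , solution-determines
  where
  open Theory.QCatalanBasis F q pow-injective P catalan e e≉0 q-catalan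
  open Coordinates f using (coordinates-exist)
  open DualForm n using (module Applied)
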